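{- Let $Q$ be a positive integer, let $x$ be the least common multiple of $1,2,\dots,Q$, and let $Y=(Y_{mn})_{m,n=1}^x$ with $Y_{mn}=\sum_{q=1}^Q S(m,n;q)$. Then for every positive integer $j$, \[ \mathrm{tr}(Y^{2j})=x^{2j}\Phi(Q),\qquad \mathrm{tr}(Y^{2j-1})=x^{2j-1}\widetilde{\Phi}(Q). \]
   Context: For integers $m,n$, the Kloosterman sum is $S(m,n;q)=\sum_{1\le k\le q,\ \gcd(k,q)=1}\exp\bigl(\frac{2\pi i}{q}(mk+nk^*)\bigr)$, where $k^*$ denotes an inverse of $k$ modulo $q$. $\varphi$ is Euler's totient function, $\Phi(Q)=\sum_{q=1}^Q\varphi(q)$, $\widetilde{\varphi}(q)=\#\{1\le k\le q:\ \gcd(k,q)=1,\ k+k^*\equiv 0\pmod q\}$ and $\widetilde{\Phi}(Q)=\sum_{q=1}^Q\widetilde{\varphi}(q)$; $\mathrm{tr}$ denotes the trace. -}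

module Defs where

open import Level using (Level)
open import Data.Bool using (Bool; true; false; if_then_else_)
open import Data.Nat using (ℕ; zero; suc; _+_; _*_; _^_; _≟_; NonZero; _<_)
open import Data.Nat.DivMod using (_/_; _%_)
open import Data.Nat.GCD using (gcd)
open import Data.Nat.LCM using (lcm)
open import Data.Fin using (Fin; toℕ)
open import Relation.Nullary using (does; ¬_)
open import Data.Product using (_×_)
open import Data.Sum using (_⊎_)
open import Algebra.Bundles using (CommutativeRing)

lcmUpTo : ℕ → ℕ
lcmUpTo zero    = 1
lcmUpTo (suc n) = lcm (suc n) (lcmUpTo n)

countUpTo : ℕ → (ℕ → Bool) → ℕ
countUpTo zero    p = 0
countUpTo (suc n) p = (if p (suc n) then 1 else 0) + countUpTo n p

coprime? : ℕ → ℕ → Bool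
coprime? k q = does (gcd k q ≟ 1)

-- least k' ∈ {1,…,n} with p k' = true (0 if none)
firstUpTo : ℕ → (ℕ → Bool) → ℕ
firstUpTo zero    p = 0
firstUpTo (suc n) p with firstUpTo n p
... | zero  = if p (suc n) then suc n else 0
... | suc m = suc m

-- k* : an inverse of k modulo q (the least one in {1,…,q}); only used for gcd(k,q)=1
modInv : (q : ℕ) → .{{NonZero q}} → ℕ → ℕ
modInv q k = firstUpTo q (λ k' → does ((k * k') % q ≟ 1 % q))

φ : (q : ℕ) → ℕ
φ q = countUpTo q (λ k → coprime? k q)

Φ : ℕ → ℕ
Φ zero    = 0
Φ (suc Q) = φ (suc Q) + Φ Q

φ̃ : (q : ℕ) → .{{NonZero q}} → ℕ
φ̃ q = countUpTo q (λ k → if coprime? k q then does ((k + modInv q k) % q ≟ 0) else false)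

Φ̃ : ℕ → ℕ
Φ̃ zero    = 0
Φ̃ (suc Q) = φ̃ (suc Q) + Φ̃ Q

-- Algebra over a commutative ring R, with a chosen element ζ playing the role of
-- exp(2πi/X); then exp(2πi t/q) for q ∣ X is ζ^((X/q)·t).
module _ {c ℓ : Level} (R : CommutativeRing c ℓ) where
  open CommutativeRing R renaming (_+_ to _+R_; _*_ to _*R_)

  powR : Carrier → ℕ → Carrier
  powR a zero    = 1#
  powR a (suc n) = a *R powR a n

  fromℕR : ℕ → Carrier
  fromℕR zero    = 0#
  fromℕR (suc n) = 1# +R fromℕR n

  sumUpTo : ℕ → (ℕ → Carrier) → Carrier
  sumUpTo zero    f = 0#
  sumUpTo (suc n) f = f (suc n) +R sumUpTo n f

  sumFin : (n : ℕ) → (Fin n → Carrier) → Carrier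
  sumFin zero    f = 0#
  sumFin (suc n) f = f Fin.zero +R sumFin n (λ i → f (Fin.suc i))

  Matrix : ℕ → Set c
  Matrix n = Fin n → Fin n → Carrier

  matMul : (n : ℕ) → Matrix n → Matrix n → Matrix n
  matMul n A B i j = sumFin n (λ k → A i k *R B k j)

  matId : (n : ℕ) → Matrix n
  matId n i j = if does (toℕ i ≟ toℕ j) then 1# else 0#

  matPow : (n : ℕ) → Matrix n → ℕ → Matrix n
  matPow n A zero    = matId n
  matPow n A (suc k) = matMul n A (matPow n A k)

  trace : (n : ℕ) → Matrix n → Carrier
  trace n A = sumFin n (λ i → A i i)

  -- Kloosterman sum S(m,n;q) = Σ_{1≤k≤q, gcd(k,q)=1} e((m k + n k*)/q),
  -- with e(t/q) = ζ^((X/q)·t) where ζ stands for exp(2πi/X) and q ∣ X.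
  kloosterman : (X : ℕ) → (ζ : Carrier) → (m n q : ℕ) → .{{NonZero q}} → Carrier
  kloosterman X ζ m n q =
    sumUpTo q (λ k → if coprime? k q
                       then powR ζ ((X / q) * (m * k + n * modInv q k))
                       else 0#)

  -- Y_{mn} = Σ_{q=1}^{Q} S(m,n;q), indices m,n ∈ {1,…,x}, x = lcm(1,…,Q)
  Ymat : (Q : ℕ) → (ζ : Carrier) → Matrix (lcmUpTo Q)
  Ymat Q ζ i j = sumUpTo Q (λ { zero → 0# ; (suc q) →
                   kloosterman (lcmUpTo Q) ζ (suc (toℕ i)) (suc (toℕ j)) (suc q) })

  PrimitiveRoot : ℕ → Carrier → Set ℓ
  PrimitiveRoot X ζ = (powR ζ X ≈ 1#) × (∀ d → 0 < d → d < X → ¬ (powR ζ d ≈ 1#))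

  IsIntegralDomain : Set (c Level.⊔ ℓ)
  IsIntegralDomain = (¬ (1# ≈ 0#)) × (∀ a b → a *R b ≈ 0# → (a ≈ 0#) ⊎ (b ≈ 0#))

-- Put α(k/q) = x·k/q and β(k/q) = x·k*/q (mod x) for the reduced fractions k/q ∈ (0,1] with q ≤ Q.
-- Since ζ plays the role of e(1/x), each Kloosterman term is ζ^(m·α + n·β), so Y = F C Fᵀ with the
-- Fourier matrix F = (ζ^(m·s)) and the 0/1 matrix C having a 1 at (α, β) for each fraction.
-- Cyclicity of the trace gives tr(Y^N) = tr((C Fᵀ F)^N), and orthogonality of characters gives
-- Fᵀ F = x·J with J_tu = [t + u ≡ 0 (mod x)]. So C Fᵀ F = x·P, where P is the partial permutation
-- sending α(k/q) to α(-k*/q) (the α are distinct). As k ↦ -k* is an involution of the units mod q,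
-- P² is the diagonal projection D onto the points α and DP = P. Hence tr(Y^2j) = x^2j·tr D = x^2j·Φ(Q)
-- and tr(Y^(2j-1)) = x^(2j-1)·tr P, where tr P counts the fractions with k ≡ -k*, i.e. Φ̃(Q).

{-# OPTIONS --safe #-}
module Submission where

open import Defs
open import Level using (Level)
open import Algebra.Bundles using (CommutativeRing)
open import Data.Bool using (Bool; true; false; if_then_else_)
open import Data.Empty using (⊥-elim)
open import Data.Fin as Fin using (Fin; toℕ)
import Data.Fin.Properties as Fin
open import Data.Nat as ℕ using (ℕ; zero; suc; z≤n; s≤s)
import Data.Nat.Properties as ℕ
import Data.Nat.DivMod as ℕ
open import Data.Nat.Tactic.RingSolver using (solve-∀)
open import Data.Product as Product using (_×_; _,_; proj₁; proj₂; Σ-syntax)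
open import Data.Sum using (_⊎_; inj₁; inj₂; [_,_]′)
open import Function using (_∘_)
open import Function.Bundles using (_⇔_; mk⇔; Equivalence)
open import Relation.Binary.Bundles using (Setoid)
import Relation.Binary.Reasoning.Setoid as SetoidReasoning
open import Relation.Binary.PropositionalEquality as ≡ using (_≡_; _≢_)
open import Relation.Nullary using (Dec; does; yes; no; ¬_; contradiction)
open import Relation.Nullary.Decidable using (dec-true; dec-false)

module _ where

  open import Relation.Binary.PropositionalEquality
  open import Data.Nat
  open import Data.Nat.Properties
  open import Data.Nat.DivMod
  open import Data.Nat.Divisibility
  open import Data.Nat.Coprimality as Coprime
    using (Coprime; coprime⇒gcd≡1; gcd≡1⇒coprime; coprime-Bézout; coprime-divisor)
  open import Data.Nat.GCD using (gcd; module Bézout)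
  open import Data.Nat.LCM using (lcm; m∣lcm[m,n]; n∣lcm[m,n]; gcd*lcm)

  dec-true⁻¹ : ∀ {a} {A : Set a} (a? : Dec A) → does a? ≡ true → A
  dec-true⁻¹ (yes a) _ = a

  coprime?⇒Coprime : ∀ {k q} → coprime? k q ≡ true → Coprime k q
  coprime?⇒Coprime e = gcd≡1⇒coprime (dec-true⁻¹ (_ ≟ 1) e)

  Coprime⇒coprime? : ∀ {k q} → Coprime k q → coprime? k q ≡ true
  Coprime⇒coprime? k⊥q = dec-true (_ ≟ 1) (coprime⇒gcd≡1 k⊥q)

  lcm≢0 : ∀ {m n} → m ≢ 0 → n ≢ 0 → lcm m n ≢ 0
  lcm≢0 {m} {n} m≢0 n≢0 lcm≡0 = [ m≢0 , n≢0 ]′ (m*n≡0⇒m≡0∨n≡0 m m*n≡0)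
    where
    m*n≡0 : m * n ≡ 0
    m*n≡0 = trans (sym (gcd*lcm m n)) (trans (cong (gcd m n *_) lcm≡0) (*-zeroʳ (gcd m n)))

  lcmUpTo≢0 : ∀ Q → lcmUpTo Q ≢ 0
  lcmUpTo≢0 zero    ()
  lcmUpTo≢0 (suc Q) = lcm≢0 (λ ()) (lcmUpTo≢0 Q)

  ∣lcmUpTo : ∀ {q Q} → 1 ≤ q → q ≤ Q → q ∣ lcmUpTo Q
  ∣lcmUpTo {Q = zero}  (s≤s _) ()
  ∣lcmUpTo {Q = suc Q} 1≤q q≤1+Q with m≤n⇒m<n∨m≡n q≤1+Q
  ... | inj₂ refl        = m∣lcm[m,n] (suc Q) (lcmUpTo Q)
  ... | inj₁ (s≤s q≤Q)   = ∣-trans (∣lcmUpTo 1≤q q≤Q) (n∣lcm[m,n] (suc Q) (lcmUpTo Q))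

  firstUpTo≡0⊎found : ∀ n p → firstUpTo n p ≡ 0 ⊎ p (firstUpTo n p) ≡ true
  firstUpTo≡0⊎found zero    p = inj₁ refl
  firstUpTo≡0⊎found (suc n) p with firstUpTo n p | firstUpTo≡0⊎found n p
  ... | suc _ | found = found
  ... | zero  | _ with p (suc n) in p[1+n]
  ...   | true  = inj₂ p[1+n]
  ...   | false = inj₁ refl

  -- r = 0 is allowed, since firstUpTo n p is 0 when no witness lies in 1..n
  firstUpTo-found : ∀ n (p : ℕ → Bool) {r} → r ≤ n → p r ≡ true → p (firstUpTo n p) ≡ true
  firstUpTo-found zero    p z≤n pr = pr
  firstUpTo-found (suc n) p {r} r≤1+n pr
    with firstUpTo n p | firstUpTo≡0⊎found n p | firstUpTo-found n p {r}
  ... | suc _ | inj₁ ()    | _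
  ... | suc _ | inj₂ found | _ = found
  ... | zero  | _          | ih with p (suc n) in p[1+n]
  ...   | true  = p[1+n]
  ...   | false with m≤n⇒m<n∨m≡n r≤1+n
  ...     | inj₂ refl      = contradiction (trans (sym pr) p[1+n]) λ ()
  ...     | inj₁ (s≤s r≤n) = ih r≤n pr

  module _ (d : ℕ) .{{_ : NonZero d}} where

    +-cong-mod : ∀ {a a′ b b′} → a % d ≡ a′ % d → b % d ≡ b′ % d → (a + b) % d ≡ (a′ + b′) % d
    +-cong-mod {a} {a′} {b} {b′} a≡a′ b≡b′ = begin
      (a + b) % d                 ≡⟨ %-distribˡ-+ a b d ⟩
      (a % d + b % d) % d         ≡⟨ cong₂ (λ u v → (u + v) % d) a≡a′ b≡b′ ⟩
      (a′ % d + b′ % d) % d       ≡⟨ %-distribˡ-+ a′ b′ d ⟨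
      (a′ + b′) % d               ∎
      where open ≡-Reasoning

    *-cong-mod : ∀ {a a′ b b′} → a % d ≡ a′ % d → b % d ≡ b′ % d → (a * b) % d ≡ (a′ * b′) % d
    *-cong-mod {a} {a′} {b} {b′} a≡a′ b≡b′ = begin
      (a * b) % d                 ≡⟨ %-distribˡ-* a b d ⟩
      (a % d * (b % d)) % d       ≡⟨ cong₂ (λ u v → (u * v) % d) a≡a′ b≡b′ ⟩
      (a′ % d * (b′ % d)) % d     ≡⟨ %-distribˡ-* a′ b′ d ⟨
      (a′ * b′) % d               ∎
      where open ≡-Reasoning

    +-cancelˡ-mod : ∀ c {v w} → v < d → w < d → (c + v) % d ≡ 0 → (c + w) % d ≡ 0 → v ≡ w
    +-cancelˡ-mod c {v} {w} v<d w<d c+v≡0 c+w≡0 = begin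
      v                   ≡⟨ m<n⇒m%n≡m v<d ⟨
      v % d               ≡⟨ %-remove-+ʳ v (m%n≡0⇒n∣m _ d c+w≡0) ⟨
      (v + (c + w)) % d   ≡⟨ cong (_% d) (swap v c w) ⟩
      (w + (c + v)) % d   ≡⟨ %-remove-+ʳ w (m%n≡0⇒n∣m _ d c+v≡0) ⟩
      w % d               ≡⟨ m<n⇒m%n≡m w<d ⟩
      w                   ∎
      where
      open ≡-Reasoning
      swap : ∀ v c w → v + (c + w) ≡ w + (c + v)
      swap = solve-∀

    %-injective : ∀ {m n} → 1 ≤ m → m ≤ d → 1 ≤ n → n ≤ d → m % d ≡ n % d → m ≡ n
    %-injective 1≤m m≤d 1≤n n≤d m≡n with m≤n⇒m<n∨m≡n m≤d | m≤n⇒m<n∨m≡n n≤d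
    ... | inj₂ refl | inj₂ refl = refl
    ... | inj₁ m<d  | inj₁ n<d  = trans (sym (m<n⇒m%n≡m m<d)) (trans m≡n (m<n⇒m%n≡m n<d))
    ... | inj₁ m<d  | inj₂ refl =
      contradiction (trans (sym (m<n⇒m%n≡m m<d)) (trans m≡n (n%n≡0 d))) (>⇒≢ 1≤m)
    ... | inj₂ refl | inj₁ n<d  =
      contradiction (trans (sym (m<n⇒m%n≡m n<d)) (trans (sym m≡n) (n%n≡0 d))) (>⇒≢ 1≤n)

  coprime⇒∃inverse : ∀ {k q} .{{_ : NonZero q}} → Coprime k q → Σ[ a ∈ ℕ ] (k * a) % q ≡ 1 % q
  coprime⇒∃inverse {k} {q} k⊥q with coprime-Bézout k⊥q
  ... | Bézout.+- a b 1+bq≡ak = a , (begin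
    (k * a) % q       ≡⟨ cong (_% q) (trans (*-comm k a) (sym 1+bq≡ak)) ⟩
    (1 + b * q) % q   ≡⟨ [m+kn]%n≡m%n 1 b q ⟩
    1 % q             ∎)
    where open ≡-Reasoning
  -- here k·a ≡ -1, so the inverse is (q - 1)·a
  ... | Bézout.-+ a b 1+ak≡bq = pred q * a , (begin
    (k * (pred q * a)) % q                ≡⟨ [m+n]%n≡m%n _ q ⟨
    (k * (pred q * a) + q) % q            ≡⟨ cong (_% q) (expand (k * (pred q * a))) ⟩
    ((k * (pred q * a) + pred q) + 1) % q ≡⟨ +-cong-mod q {a′ = 0} ≡0 refl ⟩
    (0 + 1) % q                           ∎)
    where
    open ≡-Reasoning
    expand : ∀ y → y + q ≡ (y + pred q) + 1
    expand y = trans (cong (y +_) (sym (suc-pred q))) (+-suc-as-+1 y (pred q))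
      where
      +-suc-as-+1 : ∀ y p → y + suc p ≡ (y + p) + 1
      +-suc-as-+1 = solve-∀
    ≡0 : (k * (pred q * a) + pred q) % q ≡ 0 % q
    ≡0 = begin
      (k * (pred q * a) + pred q) % q   ≡⟨ cong (_% q) (factor k (pred q) a) ⟩
      (pred q * (1 + a * k)) % q        ≡⟨ cong (λ t → (pred q * t) % q) 1+ak≡bq ⟩
      (pred q * (b * q)) % q            ≡⟨ cong (_% q) (sym (*-assoc (pred q) b q)) ⟩
      (pred q * b * q) % q              ≡⟨ m*n%n≡0 (pred q * b) q ⟩
      0                                 ≡⟨ m*n%n≡0 0 q ⟨
      0 % q                             ∎
      where
      factor : ∀ k p a → k * (p * a) + p ≡ p * (1 + a * k)
      factor = solve-∀

  modInv-inverse : ∀ {q} .{{_ : NonZero q}} {k} → Coprime k q → (k * modInv q k) % q ≡ 1 % q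
  modInv-inverse {q} {k} k⊥q = dec-true⁻¹ ((k * modInv q k) % q ≟ 1 % q)
    (firstUpTo-found q isInverse (m%n≤n a q) (dec-true ((k * (a % q)) % q ≟ 1 % q) ka%q≡1))
    where
    isInverse : ℕ → Bool
    isInverse k′ = does ((k * k′) % q ≟ 1 % q)
    a = proj₁ (coprime⇒∃inverse k⊥q)
    ka%q≡1 : (k * (a % q)) % q ≡ 1 % q
    ka%q≡1 = trans (*-cong-mod q {a = k} refl (m%n%n≡m%n a q)) (proj₂ (coprime⇒∃inverse k⊥q))

  -- the representative of -k* in {1,…,q}
  negInv : (q : ℕ) → .{{NonZero q}} → ℕ → ℕ
  negInv q k = q ∸ modInv q k % q

  module _ (q : ℕ) .{{_ : NonZero q}} (k : ℕ) where

    private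
      k* = modInv q k
      k′ = negInv q k

    1≤negInv : 1 ≤ k′
    1≤negInv = m<n⇒0<n∸m (m%n<n k* q)

    negInv≤q : k′ ≤ q
    negInv≤q = m∸n≤m q (k* % q)

    negInv+modInv%q≡q : k′ + k* % q ≡ q
    negInv+modInv%q≡q = m∸n+n≡m (m%n≤n k* q)

    ∣modInv+negInv : q ∣ k* + k′
    ∣modInv+negInv = m%n≡0⇒n∣m _ q (begin
      (k* + k′) % q        ≡⟨ +-cong-mod q {a = k* % q} (m%n%n≡m%n k* q) refl ⟨
      (k* % q + k′) % q    ≡⟨ cong (_% q) (trans (+-comm (k* % q) k′) negInv+modInv%q≡q) ⟩
      q % q                ≡⟨ n%n≡0 q ⟩
      0                    ∎)
      where open ≡-Reasoning

    negInv-coprime : Coprime k q → Coprime k′ q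
    negInv-coprime k⊥q {i} (i∣k′ , i∣q) =
      ∣1⇒≡1 (∣n∣m%n⇒∣m i∣q (subst (i ∣_) (modInv-inverse k⊥q) i∣kk*%q))
      where
      i∣k*%q : i ∣ k* % q
      i∣k*%q = ∣m+n∣m⇒∣n (subst (i ∣_) (sym negInv+modInv%q≡q) i∣q) i∣k′
      i∣kk*%q : i ∣ (k * k*) % q
      i∣kk*%q = %-presˡ-∣ (∣n⇒∣m*n k (∣n∣m%n⇒∣m i∣q i∣k*%q)) i∣q

    ∣modInv[negInv]+ : Coprime k q → q ∣ modInv q k′ + k
    ∣modInv[negInv]+ k⊥q = m%n≡0⇒n∣m _ q (begin
      (k″ + k) % q                        ≡⟨ cong (_% q) (cong₂ _+_ (*-identityʳ k″) (*-identityʳ k)) ⟨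
      (k″ * 1 + k * 1) % q                ≡⟨ +-cong-mod q (*-cong-mod q {a = k″} refl (sym k*-inverse))
                                                          (*-cong-mod q {a = k} refl (sym k″-inverse)) ⟩
      (k″ * (k * k*) + k * (k′ * k″)) % q ≡⟨ cong (_% q) (regroup k″ k k* k′) ⟩
      (k * k″ * (k* + k′)) % q            ≡⟨ n∣m⇒m%n≡0 _ q (∣n⇒∣m*n (k * k″) ∣modInv+negInv) ⟩
      0                                   ∎)
      where
      open ≡-Reasoning
      k″ = modInv q k′
      k*-inverse  = modInv-inverse k⊥q
      k″-inverse  = modInv-inverse (negInv-coprime k⊥q)
      regroup : ∀ k″ k k* k′ → k″ * (k * k*) + k * (k′ * k″) ≡ k * k″ * (k* + k′)
      regroup = solve-∀

  coprime-cross-mult⇒≡ : ∀ {k q l r} → Coprime k q → Coprime l r → k * r ≡ l * q → q ≡ r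
  coprime-cross-mult⇒≡ {k} {q} {l} {r} k⊥q l⊥r kr≡lq = ∣-antisym
    (coprime-divisor (Coprime.sym k⊥q) (divides l kr≡lq))
    (coprime-divisor (Coprime.sym l⊥r) (divides k (sym kr≡lq)))

  module _ {x q c : ℕ} .{{_ : NonZero x}} (c*q≡x : c * q ≡ x) where

    private
      instance
        c≢0 : NonZero c
        c≢0 = ≢-nonZero λ c≡0 → ≢-nonZero⁻¹ x (trans (sym c*q≡x) (cong (_* q) c≡0))

    scaled-sum≡0⇔∣ : ∀ a b → ((c * a) % x + (c * b) % x) % x ≡ 0 ⇔ q ∣ a + b
    scaled-sum≡0⇔∣ a b = mk⇔
      (λ ≡0 → *-cancelˡ-∣ c (subst (_∣ c * (a + b)) (sym c*q≡x)
                                    (m%n≡0⇒n∣m _ x (trans (sym sum≡) ≡0))))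
      (λ q∣a+b → trans sum≡ (n∣m⇒m%n≡0 _ x (subst (_∣ c * (a + b)) c*q≡x (*-monoʳ-∣ c q∣a+b))))
      where
      sum≡ : ((c * a) % x + (c * b) % x) % x ≡ (c * (a + b)) % x
      sum≡ = trans (sym (%-distribˡ-+ (c * a) (c * b) x)) (cong (_% x) (sym (*-distribˡ-+ c a b)))

  record ReducedFraction (Q q k : ℕ) : Set where
    constructor reduced
    field
      1≤k     : 1 ≤ k
      k≤q     : k ≤ q
      q≤Q     : q ≤ Q
      coprime : Coprime k q

  module FareyPoints (Q : ℕ) where

    x : ℕ
    x = lcmUpTo Q

    instance
      x≢0 : NonZero x
      x≢0 = ≢-nonZero (lcmUpTo≢0 Q)

    -- x / q, k* and -k* modulo q, with junk value 0 at the impossible denominator q = 0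
    scale : ℕ → ℕ
    scale zero    = 0
    scale (suc q) = x / suc q

    inverse : ℕ → ℕ → ℕ
    inverse zero    k = 0
    inverse (suc q) k = modInv (suc q) k

    partner : ℕ → ℕ → ℕ
    partner zero    k = 0
    partner (suc q) k = negInv (suc q) k

    α : ℕ → ℕ → ℕ
    α q k = (scale q * k) % x

    β : ℕ → ℕ → ℕ
    β q k = (scale q * inverse q k) % x

    α<x : ∀ q k → α q k < x
    α<x q k = m%n<n _ x

    β<x : ∀ q k → β q k < x
    β<x q k = m%n<n _ x

    scale*q≡x : ∀ {q} → 1 ≤ q → q ≤ Q → scale q * q ≡ x
    scale*q≡x {suc q} _ q≤Q = m/n*n≡m (∣lcmUpTo (s≤s z≤n) q≤Q)

    scale≢0 : ∀ {q} → 1 ≤ q → q ≤ Q → scale q ≢ 0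
    scale≢0 1≤q q≤Q scale≡0 = lcmUpTo≢0 Q (trans (sym (scale*q≡x 1≤q q≤Q)) (cong (_* _) scale≡0))

    module _ {q k : ℕ} (k/q : ReducedFraction Q q k) where
      open ReducedFraction k/q

      1≤q : 1 ≤ q
      1≤q = ≤-trans 1≤k k≤q

      scaled-in-range : 1 ≤ scale q * k × scale q * k ≤ x
      scaled-in-range =
        n≢0⇒n>0 (λ ≡0 → [ scale≢0 1≤q q≤Q , >⇒≢ 1≤k ]′ (m*n≡0⇒m≡0∨n≡0 _ ≡0)) ,
        subst (scale q * k ≤_) (scale*q≡x 1≤q q≤Q) (*-monoʳ-≤ (scale q) k≤q)

    α-injective : ∀ {q k r l} → ReducedFraction Q q k → ReducedFraction Q r l →
                  α q k ≡ α r l → q ≡ r × k ≡ l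
    α-injective {q} {k} {r} {l} k/q l/r αqk≡αrl = q≡r , k≡l
      where
      open ReducedFraction
      scaled≡ : scale q * k ≡ scale r * l
      scaled≡ = %-injective x (proj₁ (scaled-in-range k/q)) (proj₂ (scaled-in-range k/q))
                              (proj₁ (scaled-in-range l/r)) (proj₂ (scaled-in-range l/r)) αqk≡αrl
      kr≡lq : k * r ≡ l * q
      kr≡lq = *-cancelˡ-≡ (k * r) (l * q) x (begin
        x * (k * r)             ≡⟨ cong (_* (k * r)) (scale*q≡x (1≤q k/q) (q≤Q k/q)) ⟨
        scale q * q * (k * r)   ≡⟨ regroup (scale q) q k r ⟩
        scale q * k * (q * r)   ≡⟨ cong (_* (q * r)) scaled≡ ⟩
        scale r * l * (q * r)   ≡⟨ regroup′ (scale r) l q r ⟩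
        scale r * r * (l * q)   ≡⟨ cong (_* (l * q)) (scale*q≡x (1≤q l/r) (q≤Q l/r)) ⟩
        x * (l * q)             ∎)
        where
        open ≡-Reasoning
        regroup : ∀ a q k r → a * q * (k * r) ≡ a * k * (q * r)
        regroup = solve-∀
        regroup′ : ∀ a l q r → a * l * (q * r) ≡ a * r * (l * q)
        regroup′ = solve-∀
      q≡r : q ≡ r
      q≡r = coprime-cross-mult⇒≡ (coprime k/q) (coprime l/r) kr≡lq
      k≡l : k ≡ l
      k≡l = *-cancelʳ-≡ k l q {{>-nonZero (1≤q k/q)}} (trans (cong (k *_) q≡r) kr≡lq)

    partner-reduced : ∀ {q k} → ReducedFraction Q q k → ReducedFraction Q q (partner q k)
    partner-reduced {zero}  (reduced (s≤s _) () _ _)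
    partner-reduced {suc q} {k} (reduced _ _ q≤Q k⊥q) =
      reduced (1≤negInv (suc q) k) (negInv≤q (suc q) k) q≤Q (negInv-coprime (suc q) k k⊥q)

    private
      scaled-sum≡0⇔ : ∀ {q} → suc q ≤ Q → ∀ a b →
                      ((scale (suc q) * a) % x + (scale (suc q) * b) % x) % x ≡ 0 ⇔ suc q ∣ a + b
      scaled-sum≡0⇔ {q} q≤Q = scaled-sum≡0⇔∣ {c = scale (suc q)} (scale*q≡x (s≤s z≤n) q≤Q)

    β+α[partner]≡0 : ∀ {q k} → ReducedFraction Q q k → (β q k + α q (partner q k)) % x ≡ 0
    β+α[partner]≡0 {zero}  (reduced (s≤s _) () _ _)
    β+α[partner]≡0 {suc q} {k} (reduced _ _ q≤Q _) =
      Equivalence.from (scaled-sum≡0⇔ q≤Q (modInv (suc q) k) (negInv (suc q) k))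
                       (∣modInv+negInv (suc q) k)

    β[partner]+α≡0 : ∀ {q k} → ReducedFraction Q q k → (β q (partner q k) + α q k) % x ≡ 0
    β[partner]+α≡0 {zero}  (reduced (s≤s _) () _ _)
    β[partner]+α≡0 {suc q} {k} (reduced _ _ q≤Q k⊥q) =
      Equivalence.from (scaled-sum≡0⇔ q≤Q (modInv (suc q) (negInv (suc q) k)) k)
                       (∣modInv[negInv]+ (suc q) k k⊥q)

    β+α≡0⇔self-partner : ∀ {q k} → ReducedFraction Q (suc q) k →
                         (β (suc q) k + α (suc q) k) % x ≡ 0 ⇔ (k + modInv (suc q) k) % suc q ≡ 0
    β+α≡0⇔self-partner {q} {k} (reduced _ _ q≤Q _) = mk⇔
      (λ ≡0 → n∣m⇒m%n≡0 _ (suc q) (subst (suc q ∣_) (+-comm _ k) (Equivalence.to scaled ≡0)))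
      (λ ≡0 → Equivalence.from scaled (subst (suc q ∣_) (+-comm k _) (m%n≡0⇒n∣m _ (suc q) ≡0)))
      where
      scaled = scaled-sum≡0⇔ q≤Q (modInv (suc q) k) k

module FiniteSums {c ℓ : Level} (R : CommutativeRing c ℓ) where

  open CommutativeRing R
  open import Algebra.Properties.Semiring.Sum semiring
  open import Algebra.Properties.Semiring.Exp semiring
  open SetoidReasoning setoid

  sumFin≈sum : ∀ n (f : Fin n → Carrier) → sumFin R n f ≈ sum f
  sumFin≈sum zero    f = refl
  sumFin≈sum (suc n) f = +-congˡ (sumFin≈sum n (λ i → f (Fin.suc i)))

  powR≈^ : ∀ (a : Carrier) n → powR R a n ≈ a ^ n
  powR≈^ a zero    = refl
  powR≈^ a (suc n) = *-congˡ (powR≈^ a n)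

  fromℕR-+ : ∀ m n → fromℕR R (m ℕ.+ n) ≈ fromℕR R m + fromℕR R n
  fromℕR-+ zero    n = sym (+-identityˡ _)
  fromℕR-+ (suc m) n = trans (+-congˡ (fromℕR-+ m n)) (sym (+-assoc _ _ _))

  fromℕR-* : ∀ m n → fromℕR R (m ℕ.* n) ≈ fromℕR R m * fromℕR R n
  fromℕR-* zero    n = sym (zeroˡ _)
  fromℕR-* (suc m) n = begin
    fromℕR R (n ℕ.+ m ℕ.* n)                ≈⟨ fromℕR-+ n (m ℕ.* n) ⟩
    fromℕR R n + fromℕR R (m ℕ.* n)         ≈⟨ +-cong (sym (*-identityˡ _)) (fromℕR-* m n) ⟩
    1# * fromℕR R n + fromℕR R m * fromℕR R n  ≈⟨ distribʳ _ _ _ ⟨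
    (1# + fromℕR R m) * fromℕR R n          ∎

  fromℕR-^ : ∀ m n → fromℕR R (m ℕ.^ n) ≈ fromℕR R m ^ n
  fromℕR-^ m zero    = +-identityʳ 1#
  fromℕR-^ m (suc n) = trans (fromℕR-* m (m ℕ.^ n)) (*-congˡ (fromℕR-^ m n))

  fromℕR-^-* : ∀ m n k → fromℕR R (m ℕ.^ n ℕ.* k) ≈ fromℕR R m ^ n * fromℕR R k
  fromℕR-^-* m n k = trans (fromℕR-* (m ℕ.^ n) k) (*-congʳ (fromℕR-^ m n))

  δ : ℕ → ℕ → Carrier
  δ v w = if does (v ℕ.≟ w) then 1# else 0#

  δ-≡ : ∀ {v w} → v ≡ w → δ v w ≈ 1#
  δ-≡ {v} {w} v≡w = reflexive (≡.cong (if_then 1# else 0#) (dec-true (v ℕ.≟ w) v≡w))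

  δ-refl : ∀ v → δ v v ≈ 1#
  δ-refl v = δ-≡ {v} ≡.refl

  δ-≢ : ∀ {v w} → v ≢ w → δ v w ≈ 0#
  δ-≢ {v} {w} v≢w = reflexive (≡.cong (if_then 1# else 0#) (dec-false (v ℕ.≟ w) v≢w))

  sum-single : ∀ {n} (f : Fin n → Carrier) v {r} → v ℕ.< n →
               (∀ i → toℕ i ≡ v → f i ≈ r) → (∀ i → toℕ i ≢ v → f i ≈ 0#) → sum f ≈ r
  sum-single {suc n} f zero {r} _ at-v off-v = begin
    f Fin.zero + sum (λ i → f (Fin.suc i))   ≈⟨ +-cong (at-v Fin.zero ≡.refl) sum-zero ⟩
    r + 0#                                   ≈⟨ +-identityʳ r ⟩
    r                                        ∎
    where
    sum-zero : sum (λ i → f (Fin.suc i)) ≈ 0#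
    sum-zero = trans (sum-cong-≋ (λ i → off-v (Fin.suc i) λ ())) (sum-replicate-zero n)
  sum-single {suc n} f (suc v) {r} (s≤s v<n) at-v off-v = begin
    f Fin.zero + sum (λ i → f (Fin.suc i))   ≈⟨ +-cong (off-v Fin.zero λ ()) (sum-single (f ∘ Fin.suc) v v<n
                                                   (λ i i≡v → at-v (Fin.suc i) (≡.cong suc i≡v))
                                                   (λ i i≢v → off-v (Fin.suc i) (i≢v ∘ ℕ.suc-injective))) ⟩
    0# + r                                   ≈⟨ +-identityˡ r ⟩
    r                                        ∎

  δ-⇔ : ∀ {v₁ w₁ v₂ w₂} → (v₁ ≡ w₁ ⇔ v₂ ≡ w₂) → δ v₁ w₁ ≈ δ v₂ w₂
  δ-⇔ {v₂ = v₂} {w₂} iff with v₂ ℕ.≟ w₂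
  ... | yes v₂≡w₂ = trans (δ-≡ (Equivalence.from iff v₂≡w₂)) (sym (δ-≡ v₂≡w₂))
  ... | no  v₂≢w₂ = trans (δ-≢ (v₂≢w₂ ∘ Equivalence.to iff)) (sym (δ-≢ v₂≢w₂))

  sum-1≈fromℕR : ∀ n → ∑[ i < n ] 1# ≈ fromℕR R n
  sum-1≈fromℕR zero    = refl
  sum-1≈fromℕR (suc n) = +-congˡ (sum-1≈fromℕR n)

  sum-δ : ∀ {n} v (h : ℕ → Carrier) → v ℕ.< n → sum (λ (t : Fin n) → δ (toℕ t) v * h (toℕ t)) ≈ h v
  sum-δ v h v<n = sum-single _ v v<n
    (λ t t≡v → trans (*-cong (δ-≡ t≡v) (reflexive (≡.cong h t≡v))) (*-identityˡ (h v)))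
    (λ t t≢v → trans (*-congʳ (δ-≢ t≢v)) (zeroˡ _))

  sumUpTo-cong : ∀ n {f g : ℕ → Carrier} → (∀ k → 1 ℕ.≤ k → k ℕ.≤ n → f k ≈ g k) →
                 sumUpTo R n f ≈ sumUpTo R n g
  sumUpTo-cong zero    f≈g = refl
  sumUpTo-cong (suc n) f≈g = +-cong (f≈g (suc n) (s≤s z≤n) ℕ.≤-refl)
                                    (sumUpTo-cong n λ k 1≤k k≤n → f≈g k 1≤k (ℕ.m≤n⇒m≤1+n k≤n))

  sumUpTo-zero : ∀ n {f : ℕ → Carrier} → (∀ k → 1 ℕ.≤ k → k ℕ.≤ n → f k ≈ 0#) →
                 sumUpTo R n f ≈ 0#
  sumUpTo-zero n {f} f≈0 = trans (sumUpTo-cong n f≈0) (zeros n)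
    where
    zeros : ∀ n → sumUpTo R n (λ _ → 0#) ≈ 0#
    zeros zero    = refl
    zeros (suc n) = trans (+-identityˡ _) (zeros n)

  sumUpTo-single : ∀ n {f : ℕ → Carrier} v → 1 ℕ.≤ v → v ℕ.≤ n →
                   (∀ k → 1 ℕ.≤ k → k ℕ.≤ n → k ≢ v → f k ≈ 0#) → sumUpTo R n f ≈ f v
  sumUpTo-single zero    v 1≤v v≤0 _ = ⊥-elim (ℕ.<⇒≱ 1≤v v≤0)
  sumUpTo-single (suc n) v 1≤v v≤1+n off-v with v ℕ.≟ suc n
  ... | yes ≡.refl = trans (+-congˡ (sumUpTo-zero n λ k 1≤k k≤n →
                             off-v k 1≤k (ℕ.m≤n⇒m≤1+n k≤n) (ℕ.<⇒≢ (s≤s k≤n))))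
                           (+-identityʳ _)
  ... | no v≢1+n = trans (+-cong (off-v (suc n) (s≤s z≤n) ℕ.≤-refl (v≢1+n ∘ ≡.sym))
                                 (sumUpTo-single n v 1≤v (ℕ.≤-pred (ℕ.≤∧≢⇒< v≤1+n v≢1+n))
                                    λ k 1≤k k≤n → off-v k 1≤k (ℕ.m≤n⇒m≤1+n k≤n)))
                         (+-identityˡ _)

  *-distribˡ-sumUpTo : ∀ n a (f : ℕ → Carrier) → a * sumUpTo R n f ≈ sumUpTo R n (λ k → a * f k)
  *-distribˡ-sumUpTo zero    a f = zeroʳ a
  *-distribˡ-sumUpTo (suc n) a f = trans (distribˡ a _ _) (+-congˡ (*-distribˡ-sumUpTo n a f))

  sum-sumUpTo-comm : ∀ {m} n (f : ℕ → Fin m → Carrier) →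
                     sum (λ j → sumUpTo R n (λ k → f k j)) ≈ sumUpTo R n (λ k → sum (f k))
  sum-sumUpTo-comm {m} zero    f = sum-replicate-zero m
  sum-sumUpTo-comm     (suc n) f = trans (∑-distrib-+ (f (suc n)) _) (+-congˡ (sum-sumUpTo-comm n f))

  fromℕR-countUpTo : ∀ n p → fromℕR R (countUpTo n p) ≈ sumUpTo R n (λ k → if p k then 1# else 0#)
  fromℕR-countUpTo zero    p = refl
  fromℕR-countUpTo (suc n) p = trans (fromℕR-+ (if p (suc n) then 1 else 0) (countUpTo n p))
                                     (+-cong (indicator (p (suc n))) (fromℕR-countUpTo n p))
    where
    indicator : ∀ b → fromℕR R (if b then 1 else 0) ≈ (if b then 1# else 0#)
    indicator true  = +-identityʳ 1#
    indicator false = refl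

module Matrices {c ℓ : Level} (R : CommutativeRing c ℓ) (n : ℕ) where

  open CommutativeRing R
  open import Algebra.Properties.Semiring.Sum semiring
  open import Algebra.Properties.Semiring.Exp semiring
  open import Algebra.Properties.CommutativeSemigroup *-commutativeSemigroup using (x∙yz≈y∙xz)
  open FiniteSums R

  Mat : Set c
  Mat = Matrix R n

  infix 4 _≋_
  _≋_ : Mat → Mat → Set ℓ
  A ≋ B = ∀ i j → A i j ≈ B i j

  ≋-setoid : Setoid c ℓ
  ≋-setoid = record
    { Carrier       = Mat
    ; _≈_           = _≋_
    ; isEquivalence = record
      { refl  = λ i j → refl
      ; sym   = λ A≋B i j → sym (A≋B i j)
      ; trans = λ A≋B B≋C i j → trans (A≋B i j) (B≋C i j)
      }
    }

  open Setoid ≋-setoid public using () renaming (refl to ≋-refl; sym to ≋-sym; trans to ≋-trans)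
  module ≋-Reasoning = SetoidReasoning ≋-setoid

  infixl 7 _⊗_
  _⊗_ : Mat → Mat → Mat
  (A ⊗ B) i j = ∑[ k < n ] (A i k * B k j)

  I : Mat
  I = matId R n

  infixr 9 _^ᴹ_
  _^ᴹ_ : Mat → ℕ → Mat
  A ^ᴹ zero  = I
  A ^ᴹ suc k = A ⊗ A ^ᴹ k

  tr : Mat → Carrier
  tr A = ∑[ i < n ] A i i

  infixr 8 _·_
  _·_ : Carrier → Mat → Mat
  (a · A) i j = a * A i j

  ⊗-cong : ∀ {A A′ B B′} → A ≋ A′ → B ≋ B′ → A ⊗ B ≋ A′ ⊗ B′
  ⊗-cong A≋A′ B≋B′ i j = sum-cong-≋ λ k → *-cong (A≋A′ i k) (B≋B′ k j)

  matMul≋⊗ : ∀ A B → matMul R n A B ≋ A ⊗ B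
  matMul≋⊗ A B i j = sumFin≈sum n _

  matPow≋^ᴹ : ∀ A k → matPow R n A k ≋ A ^ᴹ k
  matPow≋^ᴹ A zero    = ≋-refl
  matPow≋^ᴹ A (suc k) = ≋-trans (matMul≋⊗ A _) (⊗-cong ≋-refl (matPow≋^ᴹ A k))

  trace≈tr : ∀ A → trace R n A ≈ tr A
  trace≈tr A = sumFin≈sum n _

  ⊗-assoc : ∀ A B C → (A ⊗ B) ⊗ C ≋ A ⊗ (B ⊗ C)
  ⊗-assoc A B C i j = begin
    ∑[ k < n ] (∑[ l < n ] (A i l * B l k) * C k j)
      ≈⟨ sum-cong-≋ (λ k → *-distribʳ-sum (C k j) (λ l → A i l * B l k)) ⟩
    ∑[ k < n ] ∑[ l < n ] (A i l * B l k * C k j)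
      ≈⟨ ∑-comm (λ k l → A i l * B l k * C k j) ⟩
    ∑[ l < n ] ∑[ k < n ] (A i l * B l k * C k j)
      ≈⟨ sum-cong-≋ (λ l → sum-cong-≋ λ k → *-assoc (A i l) (B l k) (C k j)) ⟩
    ∑[ l < n ] ∑[ k < n ] (A i l * (B l k * C k j))
      ≈⟨ sum-cong-≋ (λ l → *-distribˡ-sum (A i l) (λ k → B l k * C k j)) ⟨
    ∑[ l < n ] (A i l * ∑[ k < n ] (B l k * C k j))   ∎
    where open SetoidReasoning setoid

  ⊗-identityʳ : ∀ A → A ⊗ I ≋ A
  ⊗-identityʳ A i j = sum-single _ (toℕ j) (Fin.toℕ<n j)
    (λ k k≡j → trans (*-cong (reflexive (≡.cong (A i) (Fin.toℕ-injective k≡j))) (δ-≡ k≡j)) (*-identityʳ _))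
    (λ k k≢j → trans (*-congˡ (δ-≢ k≢j)) (zeroʳ _))

  ⊗-identityˡ : ∀ A → I ⊗ A ≋ A
  ⊗-identityˡ A i j = sum-single _ (toℕ i) (Fin.toℕ<n i)
    (λ k k≡i → trans (*-cong (δ-≡ (≡.sym k≡i)) (reflexive (≡.cong (λ l → A l j) (Fin.toℕ-injective k≡i))))
                     (*-identityˡ _))
    (λ k k≢i → trans (*-congʳ (δ-≢ (k≢i ∘ ≡.sym))) (zeroˡ _))

  tr-cong : ∀ {A B} → A ≋ B → tr A ≈ tr B
  tr-cong A≋B = sum-cong-≋ λ i → A≋B i i

  tr-⊗-comm : ∀ A B → tr (A ⊗ B) ≈ tr (B ⊗ A)
  tr-⊗-comm A B = trans (∑-comm (λ i k → A i k * B k i))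
                        (sum-cong-≋ λ k → sum-cong-≋ λ i → *-comm (A i k) (B k i))

  ·-cong : ∀ a {A B} → A ≋ B → a · A ≋ a · B
  ·-cong a A≋B i j = *-congˡ (A≋B i j)

  ·-⊗ˡ : ∀ a A B → (a · A) ⊗ B ≋ a · (A ⊗ B)
  ·-⊗ˡ a A B i j = trans (sum-cong-≋ λ k → *-assoc a (A i k) (B k j))
                         (sym (*-distribˡ-sum a (λ k → A i k * B k j)))

  ·-⊗ʳ : ∀ a A B → A ⊗ (a · B) ≋ a · (A ⊗ B)
  ·-⊗ʳ a A B i j = trans (sum-cong-≋ λ k → x∙yz≈y∙xz (A i k) a (B k j))
                         (sym (*-distribˡ-sum a (λ k → A i k * B k j)))

  tr-· : ∀ a A → tr (a · A) ≈ a * tr A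
  tr-· a A = sym (*-distribˡ-sum a (λ i → A i i))

  ^ᴹ-cong : ∀ {A B} → A ≋ B → ∀ k → A ^ᴹ k ≋ B ^ᴹ k
  ^ᴹ-cong A≋B zero    = ≋-refl
  ^ᴹ-cong A≋B (suc k) = ⊗-cong A≋B (^ᴹ-cong A≋B k)

  ·-^ᴹ : ∀ a A k → (a · A) ^ᴹ k ≋ (a ^ k) · (A ^ᴹ k)
  ·-^ᴹ a A zero    i j = sym (*-identityˡ _)
  ·-^ᴹ a A (suc k) = begin
    (a · A) ⊗ (a · A) ^ᴹ k        ≈⟨ ⊗-cong ≋-refl (·-^ᴹ a A k) ⟩
    (a · A) ⊗ (a ^ k) · A ^ᴹ k    ≈⟨ ·-⊗ˡ a A _ ⟩
    a · (A ⊗ (a ^ k) · A ^ᴹ k)    ≈⟨ ·-cong a (·-⊗ʳ (a ^ k) A _) ⟩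
    a · (a ^ k) · A ^ᴹ suc k      ≈⟨ (λ i j → sym (*-assoc _ _ _)) ⟩
    (a ^ suc k) · A ^ᴹ suc k      ∎
    where open ≋-Reasoning

  ^ᴹ-suc-factor : ∀ {Y} A B → Y ≋ A ⊗ B → ∀ k → Y ^ᴹ suc k ≋ A ⊗ ((B ⊗ A) ^ᴹ k ⊗ B)
  ^ᴹ-suc-factor {Y} A B Y≋AB zero = begin
    Y ⊗ I                         ≈⟨ ⊗-identityʳ Y ⟩
    Y                             ≈⟨ Y≋AB ⟩
    A ⊗ B                         ≈⟨ ⊗-cong ≋-refl (⊗-identityˡ B) ⟨
    A ⊗ (I ⊗ B)                   ∎
    where open ≋-Reasoning
  ^ᴹ-suc-factor {Y} A B Y≋AB (suc k) = begin
    Y ⊗ Y ^ᴹ suc k                ≈⟨ ⊗-cong Y≋AB (^ᴹ-suc-factor A B Y≋AB k) ⟩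
    A ⊗ B ⊗ (A ⊗ (W ^ᴹ k ⊗ B))    ≈⟨ ⊗-assoc A B _ ⟩
    A ⊗ (B ⊗ (A ⊗ (W ^ᴹ k ⊗ B)))  ≈⟨ ⊗-cong ≋-refl (⊗-assoc B A _) ⟨
    A ⊗ (W ⊗ (W ^ᴹ k ⊗ B))        ≈⟨ ⊗-cong ≋-refl (⊗-assoc W _ B) ⟨
    A ⊗ (W ^ᴹ suc k ⊗ B)          ∎
    where
    open ≋-Reasoning
    W = B ⊗ A

  tr-^ᴹ-rotate : ∀ {Y} A B → Y ≋ A ⊗ B → ∀ k → tr (Y ^ᴹ suc k) ≈ tr ((B ⊗ A) ^ᴹ suc k)
  tr-^ᴹ-rotate {Y} A B Y≋AB k = begin
    tr (Y ^ᴹ suc k)                 ≈⟨ tr-cong (^ᴹ-suc-factor A B Y≋AB k) ⟩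
    tr (A ⊗ (W ^ᴹ k ⊗ B))           ≈⟨ tr-⊗-comm A _ ⟩
    tr (W ^ᴹ k ⊗ B ⊗ A)             ≈⟨ tr-cong (⊗-assoc _ B A) ⟩
    tr (W ^ᴹ k ⊗ W)                 ≈⟨ tr-⊗-comm _ W ⟩
    tr (W ^ᴹ suc k)                 ∎
    where
    open SetoidReasoning setoid
    W = B ⊗ A

  module _ {P D : Mat} (P⊗P≋D : P ⊗ P ≋ D) (D⊗P≋P : D ⊗ P ≋ P) where

    ^ᴹ-odd : ∀ j → P ^ᴹ suc (2 ℕ.* j) ≋ P
    ^ᴹ-odd zero    = ⊗-identityʳ P
    ^ᴹ-odd (suc j) = begin
      P ^ᴹ suc (2 ℕ.* suc j)              ≡⟨ ≡.cong (λ m → P ^ᴹ suc m) (ℕ.*-suc 2 j) ⟩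
      P ⊗ (P ⊗ P ^ᴹ suc (2 ℕ.* j))        ≈⟨ ≋-sym (⊗-assoc P P _) ⟩
      P ⊗ P ⊗ P ^ᴹ suc (2 ℕ.* j)          ≈⟨ ⊗-cong P⊗P≋D (^ᴹ-odd j) ⟩
      D ⊗ P                               ≈⟨ D⊗P≋P ⟩
      P                                   ∎
      where open ≋-Reasoning

    ^ᴹ-even : ∀ j → P ^ᴹ suc (suc (2 ℕ.* j)) ≋ D
    ^ᴹ-even j = ≋-trans (⊗-cong ≋-refl (^ᴹ-odd j)) P⊗P≋D

module RootsOfUnity {c ℓ : Level} (R : CommutativeRing c ℓ) where

  open CommutativeRing R
  open import Algebra.Properties.Semiring.Sum semiring
  open import Algebra.Properties.Semiring.Exp semiring
  open import Algebra.Properties.Ring ring using (-1*x≈-x)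
  open import Algebra.Properties.Group +-group using (∙-cancelʳ; x∙y⁻¹≈ε⇒x≈y)
  open FiniteSums R
  open SetoidReasoning setoid

  1^n≈1 : ∀ n → 1# ^ n ≈ 1#
  1^n≈1 zero    = refl
  1^n≈1 (suc n) = trans (*-identityˡ _) (1^n≈1 n)

  ^-mod : ∀ {w m} .{{_ : ℕ.NonZero m}} → w ^ m ≈ 1# → ∀ e → w ^ e ≈ w ^ (e ℕ.% m)
  ^-mod {w} {m} w^m≈1 e = begin
    w ^ e                        ≡⟨ ≡.cong (w ^_) (ℕ.m≡m%n+[m/n]*n e m) ⟩
    w ^ (r ℕ.+ t ℕ.* m)          ≈⟨ ^-homo-* w r (t ℕ.* m) ⟩
    w ^ r * w ^ (t ℕ.* m)        ≡⟨ ≡.cong (λ u → w ^ r * w ^ u) (ℕ.*-comm t m) ⟩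
    w ^ r * w ^ (m ℕ.* t)        ≈⟨ *-congˡ (^-assocʳ w m t) ⟨
    w ^ r * (w ^ m) ^ t          ≈⟨ *-congˡ (trans (^-congˡ t w^m≈1) (1^n≈1 t)) ⟩
    w ^ r * 1#                   ≈⟨ *-identityʳ _ ⟩
    w ^ r                        ∎
    where
    r = e ℕ.% m
    t = e ℕ./ m

  powerSum : Carrier → ℕ → Carrier
  powerSum w m = ∑[ i < m ] (w ^ suc (toℕ i))

  -- w·(w + … + wᵐ) = (w + … + wᵐ) + wᵐ⁺¹ - w
  powerSum-fixed : ∀ {w} m → w ^ m ≈ 1# → w * powerSum w m ≈ powerSum w m
  powerSum-fixed {w} m w^m≈1 = ∙-cancelʳ w _ _ (begin
    w * S + w                                 ≈⟨ +-comm _ w ⟩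
    w + w * S
      ≈⟨ +-cong (sym (*-identityʳ w)) (*-distribˡ-sum w (λ (i : Fin m) → w ^ suc (toℕ i))) ⟩
    powerSum w (suc m)
      ≈⟨ sum-init-last (λ (i : Fin (suc m)) → w ^ suc (toℕ i)) ⟩
    ∑[ i < m ] (w ^ suc (toℕ (Fin.inject₁ i))) + w ^ suc (toℕ (Fin.fromℕ m))
      ≡⟨ ≡.cong₂ _+_ (sum-cong-≗ {m} λ i → ≡.cong w^1+ (Fin.toℕ-inject₁ i))
                     (≡.cong w^1+ (Fin.toℕ-fromℕ m)) ⟩
    S + w ^ suc m
      ≈⟨ +-congˡ (trans (*-congˡ w^m≈1) (*-identityʳ w)) ⟩
    S + w                                     ∎)
    where
    S = powerSum w m
    w^1+ : ℕ → Carrier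
    w^1+ j = w ^ suc j

  [w-1]*powerSum≈0 : ∀ {w} m → w ^ m ≈ 1# → (w - 1#) * powerSum w m ≈ 0#
  [w-1]*powerSum≈0 {w} m w^m≈1 = begin
    (w - 1#) * S              ≈⟨ distribʳ S w (- 1#) ⟩
    w * S + - 1# * S          ≈⟨ +-cong (powerSum-fixed m w^m≈1) (-1*x≈-x S) ⟩
    S - S                     ≈⟨ -‿inverseʳ S ⟩
    0#                        ∎
    where
    S = powerSum w m

  powerSum-root-of-unity : IsIntegralDomain R → ∀ {w} m → w ^ m ≈ 1# → w ≈ 1# ⊎ powerSum w m ≈ 0#
  powerSum-root-of-unity (_ , no-zero-divisors) {w} m w^m≈1
    with no-zero-divisors (w - 1#) (powerSum w m) ([w-1]*powerSum≈0 m w^m≈1)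
  ... | inj₁ w-1≈0 = inj₁ (x∙y⁻¹≈ε⇒x≈y w 1# w-1≈0)
  ... | inj₂ S≈0   = inj₂ S≈0

  module _ {x : ℕ} .{{_ : ℕ.NonZero x}} {ζ : Carrier} (ζ-primitive : PrimitiveRoot R x ζ) where

    ζ^x≈1 : ζ ^ x ≈ 1#
    ζ^x≈1 = trans (sym (powR≈^ ζ x)) (proj₁ ζ-primitive)

    powerSum-primitive : IsIntegralDomain R → ∀ e → powerSum (ζ ^ e) x ≈ fromℕR R x * δ (e ℕ.% x) 0
    powerSum-primitive domain e with e ℕ.% x ℕ.≟ 0
    ... | yes e%x≡0 = begin
      powerSum (ζ ^ e) x
        ≈⟨ sum-cong-≋ {x} (λ i → trans (^-congˡ (suc (toℕ i)) ζ^e≈1) (1^n≈1 (suc (toℕ i)))) ⟩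
      ∑[ i < x ] 1#                     ≈⟨ sum-1≈fromℕR x ⟩
      fromℕR R x                        ≈⟨ *-identityʳ _ ⟨
      fromℕR R x * 1#                   ≈⟨ *-congˡ (δ-≡ e%x≡0) ⟨
      fromℕR R x * δ (e ℕ.% x) 0        ∎
      where
      ζ^e≈1 : ζ ^ e ≈ 1#
      ζ^e≈1 = trans (^-mod ζ^x≈1 e) (reflexive (≡.cong (ζ ^_) e%x≡0))
    ... | no e%x≢0 with powerSum-root-of-unity domain x [ζ^e]^x≈1
      where
      [ζ^e]^x≈1 : (ζ ^ e) ^ x ≈ 1#
      [ζ^e]^x≈1 = begin
        (ζ ^ e) ^ x           ≈⟨ ^-assocʳ ζ e x ⟩
        ζ ^ (e ℕ.* x)         ≡⟨ ≡.cong (ζ ^_) (ℕ.*-comm e x) ⟩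
        ζ ^ (x ℕ.* e)         ≈⟨ ^-assocʳ ζ x e ⟨
        (ζ ^ x) ^ e           ≈⟨ trans (^-congˡ e ζ^x≈1) (1^n≈1 e) ⟩
        1#                    ∎
    ...   | inj₂ S≈0   = trans S≈0 (trans (sym (zeroʳ _)) (*-congˡ (sym (δ-≢ e%x≢0))))
    ...   | inj₁ ζ^e≈1 = ⊥-elim (proj₂ ζ-primitive (e ℕ.% x) (ℕ.n≢0⇒n>0 e%x≢0) (ℕ.m%n<n e x)
                           (trans (powR≈^ ζ (e ℕ.% x)) (trans (sym (^-mod ζ^x≈1 e)) ζ^e≈1)))

module FareySums {c ℓ : Level} (R : CommutativeRing c ℓ) where

  open CommutativeRing R
  open import Algebra.Properties.Semiring.Sum semiring
  open FiniteSums R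

  restrict : ℕ → ℕ → Carrier → Carrier
  restrict q k a = if coprime? k q then a else 0#

  -- Σ over the reduced fractions k/q ∈ (0,1] with q ≤ Q
  fareySum : ℕ → (ℕ → ℕ → Carrier) → Carrier
  fareySum Q g = sumUpTo R Q (λ q → sumUpTo R q (λ k → restrict q k (g q k)))

  private
    restrict-cong : ∀ {Q q k a b} → 1 ℕ.≤ k → k ℕ.≤ q → q ℕ.≤ Q →
                    (ReducedFraction Q q k → a ≈ b) → restrict q k a ≈ restrict q k b
    restrict-cong {q = q} {k} 1≤k k≤q q≤Q a≈b with coprime? k q in k⊥q
    ... | true  = a≈b (reduced 1≤k k≤q q≤Q (coprime?⇒Coprime k⊥q))
    ... | false = refl

    restrict-0 : ∀ q k → restrict q k 0# ≈ 0#
    restrict-0 q k with coprime? k q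
    ... | true  = refl
    ... | false = refl

    *-restrict : ∀ a q k b → a * restrict q k b ≈ restrict q k (a * b)
    *-restrict a q k b with coprime? k q
    ... | true  = refl
    ... | false = zeroʳ a

    sum-restrict : ∀ {n} q k (f : Fin n → Carrier) →
                   ∑[ t < n ] restrict q k (f t) ≈ restrict q k (sum f)
    sum-restrict {n} q k f with coprime? k q
    ... | true  = refl
    ... | false = sum-replicate-zero n

  fareySum-cong : ∀ Q {g h : ℕ → ℕ → Carrier} → (∀ {q k} → ReducedFraction Q q k → g q k ≈ h q k) →
                  fareySum Q g ≈ fareySum Q h
  fareySum-cong Q g≈h =
    sumUpTo-cong Q λ q _ q≤Q → sumUpTo-cong q λ k 1≤k k≤q → restrict-cong 1≤k k≤q q≤Q g≈h

  fareySum-single : ∀ Q {g : ℕ → ℕ → Carrier} {q₀ k₀} → ReducedFraction Q q₀ k₀ →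
                    (∀ {q k} → ReducedFraction Q q k → ¬ (q ≡ q₀ × k ≡ k₀) → g q k ≈ 0#) →
                    fareySum Q g ≈ g q₀ k₀
  fareySum-single Q {g} {q₀} {k₀} (reduced 1≤k₀ k₀≤q₀ q₀≤Q k₀⊥q₀) elsewhere = begin
    fareySum Q g
      ≈⟨ sumUpTo-single Q q₀ (ℕ.≤-trans 1≤k₀ k₀≤q₀) q₀≤Q other-q ⟩
    sumUpTo R q₀ (λ k → restrict q₀ k (g q₀ k))
      ≈⟨ sumUpTo-single q₀ k₀ 1≤k₀ k₀≤q₀ other-k ⟩
    restrict q₀ k₀ (g q₀ k₀)
      ≡⟨ ≡.cong (if_then g q₀ k₀ else 0#) (Coprime⇒coprime? k₀⊥q₀) ⟩
    g q₀ k₀                                        ∎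
    where
    open SetoidReasoning setoid
    vanishes : ∀ {q k} → 1 ℕ.≤ k → k ℕ.≤ q → q ℕ.≤ Q → ¬ (q ≡ q₀ × k ≡ k₀) →
               restrict q k (g q k) ≈ 0#
    vanishes {q} {k} 1≤k k≤q q≤Q ≢ =
      trans (restrict-cong 1≤k k≤q q≤Q (λ k/q → elsewhere k/q ≢)) (restrict-0 q k)
    other-q : ∀ q → 1 ℕ.≤ q → q ℕ.≤ Q → q ≢ q₀ → sumUpTo R q (λ k → restrict q k (g q k)) ≈ 0#
    other-q q _ q≤Q q≢q₀ = sumUpTo-zero q λ k 1≤k k≤q → vanishes 1≤k k≤q q≤Q (q≢q₀ ∘ proj₁)
    other-k : ∀ k → 1 ℕ.≤ k → k ℕ.≤ q₀ → k ≢ k₀ → restrict q₀ k (g q₀ k) ≈ 0#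
    other-k k 1≤k k≤q₀ k≢k₀ = vanishes 1≤k k≤q₀ q₀≤Q (k≢k₀ ∘ proj₂)

  *-distribˡ-fareySum : ∀ Q a g → a * fareySum Q g ≈ fareySum Q (λ q k → a * g q k)
  *-distribˡ-fareySum Q a g = trans (*-distribˡ-sumUpTo Q a _) (sumUpTo-cong Q λ q _ _ →
    trans (*-distribˡ-sumUpTo q a _) (sumUpTo-cong q λ k _ _ → *-restrict a q k (g q k)))

  *-distribʳ-fareySum : ∀ Q a g → fareySum Q g * a ≈ fareySum Q (λ q k → g q k * a)
  *-distribʳ-fareySum Q a g =
    trans (*-comm _ a) (trans (*-distribˡ-fareySum Q a g) (fareySum-cong Q λ _ → *-comm a _))

  sum-fareySum-comm : ∀ {n} Q (g : Fin n → ℕ → ℕ → Carrier) →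
                      ∑[ t < n ] fareySum Q (g t) ≈ fareySum Q (λ q k → ∑[ t < n ] g t q k)
  sum-fareySum-comm {n} Q g = trans (sum-sumUpTo-comm {n} Q _) (sumUpTo-cong Q λ q _ _ →
    trans (sum-sumUpTo-comm {n} q _) (sumUpTo-cong q λ k _ _ → sum-restrict q k (λ t → g t q k)))

  fareySum-1≈Φ : ∀ Q → fareySum Q (λ _ _ → 1#) ≈ fromℕR R (Φ Q)
  fareySum-1≈Φ zero    = refl
  fareySum-1≈Φ (suc Q) = trans (+-cong (sym (fromℕR-countUpTo (suc Q) _)) (fareySum-1≈Φ Q))
                               (sym (fromℕR-+ (φ (suc Q)) (Φ Q)))

  -- 1 when k ≡ -k* (mod q); junk 0 at q = 0
  selfPartner : ℕ → ℕ → Carrier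
  selfPartner zero    k = 0#
  selfPartner (suc q) k = δ ((k ℕ.+ modInv (suc q) k) ℕ.% suc q) 0

  fareySum-selfPartner≈Φ̃ : ∀ Q → fareySum Q selfPartner ≈ fromℕR R (Φ̃ Q)
  fareySum-selfPartner≈Φ̃ zero    = refl
  fareySum-selfPartner≈Φ̃ (suc Q) =
    trans (+-cong (trans (sumUpTo-cong (suc Q) λ k _ _ → restrict-selfPartner k)
                         (sym (fromℕR-countUpTo (suc Q) _)))
                  (fareySum-selfPartner≈Φ̃ Q))
          (sym (fromℕR-+ (φ̃ (suc Q)) (Φ̃ Q)))
    where
    restrict-selfPartner : ∀ k →
      restrict (suc Q) k (selfPartner (suc Q) k) ≈
      (if (if coprime? k (suc Q) then does ((k ℕ.+ modInv (suc Q) k) ℕ.% suc Q ℕ.≟ 0) else false)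
       then 1# else 0#)
    restrict-selfPartner k with coprime? k (suc Q)
    ... | true  = refl
    ... | false = refl

module KloostermanMatrix {c ℓ : Level} (R : CommutativeRing c ℓ) (domain : IsIntegralDomain R) (Q : ℕ)
                         (ζ : CommutativeRing.Carrier R) (ζ-primitive : PrimitiveRoot R (lcmUpTo Q) ζ) where

  open CommutativeRing R
  open import Algebra.Properties.Semiring.Sum semiring
  open import Algebra.Properties.Semiring.Exp semiring
  open FiniteSums R
  open FareySums R
  open RootsOfUnity R
  open FareyPoints Q
  open Matrices R x

  ∑ᶠ : (ℕ → ℕ → Carrier) → Carrier
  ∑ᶠ = fareySum Q

  Y : Mat
  Y = Ymat R Q ζ

  F : Mat
  F i s = ζ ^ (toℕ s ℕ.* suc (toℕ i))

  Fᵀ : Mat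
  Fᵀ t j = F j t

  C : Mat
  C s t = ∑ᶠ λ q k → δ (toℕ s) (α q k) * δ (toℕ t) (β q k)

  J : Mat
  J t u = δ ((toℕ t ℕ.+ toℕ u) ℕ.% x) 0

  perm : ℕ → ℕ → Carrier
  perm s u = ∑ᶠ λ q k → δ s (α q k) * δ ((β q k ℕ.+ u) ℕ.% x) 0

  P : Mat
  P s u = perm (toℕ s) (toℕ u)

  D : Mat
  D s u = ∑ᶠ λ q k → δ (toℕ s) (α q k) * δ (toℕ u) (α q k)

  ^ᶻ-cong-mod : ∀ {e e′} → e ℕ.% x ≡ e′ ℕ.% x → ζ ^ e ≈ ζ ^ e′
  ^ᶻ-cong-mod {e} {e′} e≡e′ = trans (^-mod (ζ^x≈1 ζ-primitive) e)
    (trans (reflexive (≡.cong (ζ ^_) e≡e′)) (sym (^-mod (ζ^x≈1 ζ-primitive) e′)))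

  δ-+-cancel : ∀ a {v w} → v ℕ.< x → w ℕ.< x → (a ℕ.+ w) ℕ.% x ≡ 0 →
               δ ((a ℕ.+ v) ℕ.% x) 0 ≈ δ v w
  δ-+-cancel a v<x w<x a+w≡0 = δ-⇔ (mk⇔ (λ a+v≡0 → +-cancelˡ-mod x a v<x w<x a+v≡0 a+w≡0)
                                       (λ { ≡.refl → a+w≡0 }))

  ∑ᶠ-⊗-δ : ∀ (a : ℕ → ℕ → Carrier) (v : ℕ → ℕ → ℕ) (h : ℕ → Carrier) → (∀ q k → v q k ℕ.< x) →
           ∑[ t < x ] (∑ᶠ (λ q k → a q k * δ (toℕ t) (v q k)) * h (toℕ t))
           ≈ ∑ᶠ λ q k → a q k * h (v q k)
  ∑ᶠ-⊗-δ a v h v<x = begin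
    ∑[ t < x ] (∑ᶠ (λ q k → a q k * δ (toℕ t) (v q k)) * h (toℕ t))
      ≈⟨ sum-cong-≋ {x} (λ t → *-distribʳ-fareySum Q (h (toℕ t)) _) ⟩
    ∑[ t < x ] ∑ᶠ (λ q k → a q k * δ (toℕ t) (v q k) * h (toℕ t))
      ≈⟨ sum-fareySum-comm {x} Q _ ⟩
    ∑ᶠ (λ q k → ∑[ t < x ] (a q k * δ (toℕ t) (v q k) * h (toℕ t)))
      ≈⟨ fareySum-cong Q (λ {q} {k} _ → begin
           ∑[ t < x ] (a q k * δ (toℕ t) (v q k) * h (toℕ t))   ≈⟨ sum-cong-≋ {x} (λ t → *-assoc _ _ _) ⟩
           ∑[ t < x ] (a q k * (δ (toℕ t) (v q k) * h (toℕ t))) ≈⟨ *-distribˡ-sum (a q k) (δ·h q k) ⟨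
           a q k * ∑[ t < x ] (δ (toℕ t) (v q k) * h (toℕ t))   ≈⟨ *-congˡ (sum-δ (v q k) h (v<x q k)) ⟩
           a q k * h (v q k)                                    ∎) ⟩
    ∑ᶠ (λ q k → a q k * h (v q k))  ∎
    where
    open SetoidReasoning setoid
    δ·h : ℕ → ℕ → Fin x → Carrier
    δ·h q k t = δ (toℕ t) (v q k) * h (toℕ t)

  perm-row : ∀ {q k} → ReducedFraction Q q k → ∀ u → perm (α q k) u ≈ δ ((β q k ℕ.+ u) ℕ.% x) 0
  perm-row {q} {k} k/q u =
    trans (fareySum-single Q k/q off-row) (trans (*-congʳ (δ-refl (α q k))) (*-identityˡ _))
    where
    off-row : ∀ {r l} → ReducedFraction Q r l → ¬ (r ≡ q × l ≡ k) →
              δ (α q k) (α r l) * δ ((β r l ℕ.+ u) ℕ.% x) 0 ≈ 0#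
    off-row l/r ≢ = trans (*-congʳ (δ-≢ λ α≡α′ → ≢ (Product.map ≡.sym ≡.sym (α-injective k/q l/r α≡α′))))
                          (zeroˡ _)

  Fᵀ⊗F≋x·J : Fᵀ ⊗ F ≋ fromℕR R x · J
  Fᵀ⊗F≋x·J t u = begin
    ∑[ n < x ] (ζ ^ (toℕ t ℕ.* suc (toℕ n)) * ζ ^ (toℕ u ℕ.* suc (toℕ n)))
      ≈⟨ sum-cong-≋ {x} (λ n → merge (toℕ t) (toℕ u) (suc (toℕ n))) ⟩
    powerSum (ζ ^ (toℕ t ℕ.+ toℕ u)) x
      ≈⟨ powerSum-primitive ζ-primitive domain (toℕ t ℕ.+ toℕ u) ⟩
    fromℕR R x * J t u  ∎
    where
    open SetoidReasoning setoid
    merge : ∀ a b m → ζ ^ (a ℕ.* m) * ζ ^ (b ℕ.* m) ≈ (ζ ^ (a ℕ.+ b)) ^ m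
    merge a b m = begin
      ζ ^ (a ℕ.* m) * ζ ^ (b ℕ.* m)    ≈⟨ ^-homo-* ζ (a ℕ.* m) (b ℕ.* m) ⟨
      ζ ^ (a ℕ.* m ℕ.+ b ℕ.* m)        ≡⟨ ≡.cong (ζ ^_) (ℕ.*-distribʳ-+ m a b) ⟨
      ζ ^ ((a ℕ.+ b) ℕ.* m)            ≈⟨ ^-assocʳ ζ (a ℕ.+ b) m ⟨
      (ζ ^ (a ℕ.+ b)) ^ m              ∎

  C⊗J≋P : C ⊗ J ≋ P
  C⊗J≋P s u = ∑ᶠ-⊗-δ (λ q k → δ (toℕ s) (α q k)) β (λ w → δ ((w ℕ.+ toℕ u) ℕ.% x) 0) β<x

  C⊗Fᵀ⊗F≋x·P : C ⊗ Fᵀ ⊗ F ≋ fromℕR R x · P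
  C⊗Fᵀ⊗F≋x·P = begin
    C ⊗ Fᵀ ⊗ F               ≈⟨ ⊗-assoc C Fᵀ F ⟩
    C ⊗ (Fᵀ ⊗ F)             ≈⟨ ⊗-cong ≋-refl Fᵀ⊗F≋x·J ⟩
    C ⊗ (fromℕR R x · J)     ≈⟨ ·-⊗ʳ (fromℕR R x) C J ⟩
    fromℕR R x · (C ⊗ J)     ≈⟨ ·-cong (fromℕR R x) C⊗J≋P ⟩
    fromℕR R x · P           ∎
    where open ≋-Reasoning

  ^ᶻ-*-mod : ∀ a m → ζ ^ (a ℕ.* m) ≈ ζ ^ ((a ℕ.% x) ℕ.* m)
  ^ᶻ-*-mod a m = ^ᶻ-cong-mod (*-cong-mod x (≡.sym (ℕ.m%n%n≡m%n a x)) ≡.refl)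

  Y-entry : ∀ i j → Y i j ≈ ∑ᶠ λ q k → ζ ^ (α q k ℕ.* suc (toℕ i)) * ζ ^ (β q k ℕ.* suc (toℕ j))
  Y-entry i j = trans (sumUpTo-cong Q λ { (suc q) _ _ → refl }) (fareySum-cong Q λ {q} {k} _ →
    let e = scale q ℕ.* (m ℕ.* k ℕ.+ n ℕ.* inverse q k)
        a = scale q ℕ.* k
        b = scale q ℕ.* inverse q k
    in begin
    powR R ζ e                               ≈⟨ powR≈^ ζ e ⟩
    ζ ^ e                                    ≡⟨ ≡.cong (ζ ^_) (expand (scale q) m k n (inverse q k)) ⟩
    ζ ^ (a ℕ.* m ℕ.+ b ℕ.* n)                ≈⟨ ^-homo-* ζ (a ℕ.* m) (b ℕ.* n) ⟩
    ζ ^ (a ℕ.* m) * ζ ^ (b ℕ.* n)            ≈⟨ *-cong (^ᶻ-*-mod a m) (^ᶻ-*-mod b n) ⟩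
    ζ ^ (α q k ℕ.* m) * ζ ^ (β q k ℕ.* n)    ∎)
    where
    open SetoidReasoning setoid
    m = suc (toℕ i)
    n = suc (toℕ j)
    expand : ∀ a m k n k* → a ℕ.* (m ℕ.* k ℕ.+ n ℕ.* k*) ≡ a ℕ.* k ℕ.* m ℕ.+ a ℕ.* k* ℕ.* n
    expand = solve-∀

  Y≋F⊗C⊗Fᵀ : Y ≋ F ⊗ (C ⊗ Fᵀ)
  Y≋F⊗C⊗Fᵀ i j = sym (begin
    ∑[ s < x ] (F i s * (C ⊗ Fᵀ) s j)
      ≈⟨ sum-cong-≋ {x} (λ s → trans (*-comm _ _) (*-congʳ (C⊗Fᵀ-entry s))) ⟩
    ∑[ s < x ] (∑ᶠ (λ q k → ζ ^ (β q k ℕ.* n) * δ (toℕ s) (α q k)) * F i s)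
      ≈⟨ ∑ᶠ-⊗-δ (λ q k → ζ ^ (β q k ℕ.* n)) α (λ w → ζ ^ (w ℕ.* m)) α<x ⟩
    ∑ᶠ (λ q k → ζ ^ (β q k ℕ.* n) * ζ ^ (α q k ℕ.* m))
      ≈⟨ fareySum-cong Q (λ _ → *-comm _ _) ⟩
    ∑ᶠ (λ q k → ζ ^ (α q k ℕ.* m) * ζ ^ (β q k ℕ.* n))
      ≈⟨ Y-entry i j ⟨
    Y i j ∎)
    where
    open SetoidReasoning setoid
    m = suc (toℕ i)
    n = suc (toℕ j)
    C⊗Fᵀ-entry : ∀ s → (C ⊗ Fᵀ) s j ≈ ∑ᶠ λ q k → ζ ^ (β q k ℕ.* n) * δ (toℕ s) (α q k)
    C⊗Fᵀ-entry s = trans (∑ᶠ-⊗-δ (λ q k → δ (toℕ s) (α q k)) β (λ w → ζ ^ (w ℕ.* n)) β<x)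
                         (fareySum-cong Q λ _ → *-comm _ _)

  P-via-partner : ∀ s t → P s t ≈ ∑ᶠ λ q k → δ (toℕ s) (α q k) * δ (toℕ t) (α q (partner q k))
  P-via-partner s t = fareySum-cong Q λ {q} {k} k/q →
    *-congˡ (δ-+-cancel (β q k) (Fin.toℕ<n t) (α<x q (partner q k)) (β+α[partner]≡0 k/q))

  P⊗P≋D : P ⊗ P ≋ D
  P⊗P≋D s u = begin
    ∑[ t < x ] (P s t * P t u)
      ≈⟨ sum-cong-≋ {x} (λ t → *-congʳ (P-via-partner s t)) ⟩
    ∑[ t < x ] (∑ᶠ (λ q k → δ (toℕ s) (α q k) * δ (toℕ t) (α′ q k)) * perm (toℕ t) (toℕ u))
      ≈⟨ ∑ᶠ-⊗-δ (λ q k → δ (toℕ s) (α q k)) α′ (λ w → perm w (toℕ u)) (λ q k → α<x q _) ⟩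
    ∑ᶠ (λ q k → δ (toℕ s) (α q k) * perm (α′ q k) (toℕ u))
      ≈⟨ fareySum-cong Q (λ k/q → *-congˡ (partner-row k/q)) ⟩
    D s u ∎
    where
    open SetoidReasoning setoid
    α′ : ℕ → ℕ → ℕ
    α′ q k = α q (partner q k)
    partner-row : ∀ {q k} → ReducedFraction Q q k → perm (α′ q k) (toℕ u) ≈ δ (toℕ u) (α q k)
    partner-row {q} {k} k/q = trans (perm-row (partner-reduced k/q) (toℕ u))
      (δ-+-cancel (β q (partner q k)) (Fin.toℕ<n u) (α<x q k) (β[partner]+α≡0 k/q))

  D⊗P≋P : D ⊗ P ≋ P
  D⊗P≋P s u = begin
    ∑[ t < x ] (D s t * P t u)
      ≈⟨ ∑ᶠ-⊗-δ (λ q k → δ (toℕ s) (α q k)) α (λ w → perm w (toℕ u)) α<x ⟩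
    ∑ᶠ (λ q k → δ (toℕ s) (α q k) * perm (α q k) (toℕ u))
      ≈⟨ fareySum-cong Q (λ k/q → *-congˡ (perm-row k/q (toℕ u))) ⟩
    P s u ∎
    where open SetoidReasoning setoid

  tr-D : tr D ≈ fromℕR R (Φ Q)
  tr-D = begin
    ∑[ s < x ] D s s
      ≈⟨ sum-fareySum-comm {x} Q _ ⟩
    ∑ᶠ (λ q k → ∑[ s < x ] (δ (toℕ s) (α q k) * δ (toℕ s) (α q k)))
      ≈⟨ fareySum-cong Q (λ {q} {k} _ → trans (sum-δ (α q k) (λ w → δ w (α q k)) (α<x q k))
                                                  (δ-refl (α q k))) ⟩
    ∑ᶠ (λ _ _ → 1#)
      ≈⟨ fareySum-1≈Φ Q ⟩
    fromℕR R (Φ Q) ∎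
    where open SetoidReasoning setoid

  tr-P : tr P ≈ fromℕR R (Φ̃ Q)
  tr-P = begin
    ∑[ s < x ] P s s
      ≈⟨ sum-fareySum-comm {x} Q _ ⟩
    ∑ᶠ (λ q k → ∑[ s < x ] (δ (toℕ s) (α q k) * δ ((β q k ℕ.+ toℕ s) ℕ.% x) 0))
      ≈⟨ fareySum-cong Q diagonal ⟩
    ∑ᶠ selfPartner
      ≈⟨ fareySum-selfPartner≈Φ̃ Q ⟩
    fromℕR R (Φ̃ Q) ∎
    where
    open SetoidReasoning setoid
    diagonal : ∀ {q k} → ReducedFraction Q q k →
               ∑[ s < x ] (δ (toℕ s) (α q k) * δ ((β q k ℕ.+ toℕ s) ℕ.% x) 0) ≈ selfPartner q k
    diagonal {zero}  (reduced (s≤s _) () _ _)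
    diagonal {suc q} {k} k/q =
      trans (sum-δ (α (suc q) k) (λ w → δ ((β (suc q) k ℕ.+ w) ℕ.% x) 0) (α<x (suc q) k))
            (δ-⇔ (β+α≡0⇔self-partner k/q))

  trace-Y^suc : ∀ k → trace R x (matPow R x Y (suc k)) ≈ fromℕR R x ^ suc k * tr (P ^ᴹ suc k)
  trace-Y^suc k = begin
    trace R x (matPow R x Y (suc k))                   ≈⟨ trace≈tr (matPow R x Y (suc k)) ⟩
    tr (matPow R x Y (suc k))                          ≈⟨ tr-cong (matPow≋^ᴹ Y (suc k)) ⟩
    tr (Y ^ᴹ suc k)                                    ≈⟨ tr-^ᴹ-rotate F (C ⊗ Fᵀ) Y≋F⊗C⊗Fᵀ k ⟩
    tr ((C ⊗ Fᵀ ⊗ F) ^ᴹ suc k)                         ≈⟨ tr-cong (^ᴹ-cong C⊗Fᵀ⊗F≋x·P (suc k)) ⟩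
    tr ((fromℕR R x · P) ^ᴹ suc k)                     ≈⟨ tr-cong (·-^ᴹ (fromℕR R x) P (suc k)) ⟩
    tr ((fromℕR R x ^ suc k) · P ^ᴹ suc k)             ≈⟨ tr-· (fromℕR R x ^ suc k) (P ^ᴹ suc k) ⟩
    fromℕR R x ^ suc k * tr (P ^ᴹ suc k)               ∎
    where open SetoidReasoning setoid

  trace-Y^even : ∀ j → trace R x (matPow R x Y (2 ℕ.* suc j))
                       ≈ fromℕR R (x ℕ.^ (2 ℕ.* suc j) ℕ.* Φ Q)
  trace-Y^even j = ≡.subst (λ N → trace R x (matPow R x Y N) ≈ fromℕR R (x ℕ.^ N ℕ.* Φ Q))
                           (≡.sym (ℕ.*-suc 2 j)) (begin
    trace R x (matPow R x Y N)          ≈⟨ trace-Y^suc (suc (2 ℕ.* j)) ⟩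
    fromℕR R x ^ N * tr (P ^ᴹ N)        ≈⟨ *-congˡ (tr-cong (^ᴹ-even P⊗P≋D D⊗P≋P j)) ⟩
    fromℕR R x ^ N * tr D               ≈⟨ *-congˡ tr-D ⟩
    fromℕR R x ^ N * fromℕR R (Φ Q)     ≈⟨ fromℕR-^-* x N (Φ Q) ⟨
    fromℕR R (x ℕ.^ N ℕ.* Φ Q)          ∎)
    where
    open SetoidReasoning setoid
    N = suc (suc (2 ℕ.* j))

  trace-Y^odd : ∀ j → trace R x (matPow R x Y (2 ℕ.* suc j ℕ.∸ 1))
                      ≈ fromℕR R (x ℕ.^ (2 ℕ.* suc j ℕ.∸ 1) ℕ.* Φ̃ Q)
  trace-Y^odd j = ≡.subst (λ N → trace R x (matPow R x Y N) ≈ fromℕR R (x ℕ.^ N ℕ.* Φ̃ Q))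
                          (≡.cong (ℕ._∸ 1) (≡.sym (ℕ.*-suc 2 j))) (begin
    trace R x (matPow R x Y N)          ≈⟨ trace-Y^suc (2 ℕ.* j) ⟩
    fromℕR R x ^ N * tr (P ^ᴹ N)        ≈⟨ *-congˡ (tr-cong (^ᴹ-odd P⊗P≋D D⊗P≋P j)) ⟩
    fromℕR R x ^ N * tr P               ≈⟨ *-congˡ tr-P ⟩
    fromℕR R x ^ N * fromℕR R (Φ̃ Q)     ≈⟨ fromℕR-^-* x N (Φ̃ Q) ⟨
    fromℕR R (x ℕ.^ N ℕ.* Φ̃ Q)          ∎)
    where
    open SetoidReasoning setoid
    N = suc (2 ℕ.* j)

-- opened only here, where they no longer clash with the ring operators
open import Data.Nat using (_*_; _^_; _≥_; _∸_)

lemma13 : {c ℓ : Level} (R : CommutativeRing c ℓ) → IsIntegralDomain R →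
    (Q : ℕ) → Q ≥ 1 →
    (ζ : CommutativeRing.Carrier R) → PrimitiveRoot R (lcmUpTo Q) ζ →
    (j : ℕ) → j ≥ 1 →
    (CommutativeRing._≈_ R
      (trace R (lcmUpTo Q) (matPow R (lcmUpTo Q) (Ymat R Q ζ) (2 * j)))
      (fromℕR R (lcmUpTo Q ^ (2 * j) * Φ Q)))
    ×
    (CommutativeRing._≈_ R
      (trace R (lcmUpTo Q) (matPow R (lcmUpTo Q) (Ymat R Q ζ) (2 * j ∸ 1)))
      (fromℕR R (lcmUpTo Q ^ (2 * j ∸ 1) * Φ̃ Q)))
lemma13 R domain Q _ ζ ζ-primitive (suc j) _ = trace-Y^even j , trace-Y^odd j
  where open KloostermanMatrix R domain Q ζ ζ-primitive
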